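{- For all positive integers $a,b$, the pattern $[a\,b\,a\,b]$ is forbidden; that is, no path in any skip graph has four consecutive edges that are an $a$-arc, a $b$-arc, an $a$-arc and a $b$-arc in this order.
   Context: For a finite set $S$ of positive integers, the skip graph $G(S)$ has vertex set $\mathbb{N}=\{0,1,2,\dots\}$ and, for each $s\in S$ and $j\ge0$, an edge (an $s$-arc) between $2js$ and $(2j+1)s$. An unsigned pattern $[a_1\dots a_n]$ of positive integers is realizable if there exist signs $\epsilon_k\in\{\pm1\}$ and an integer $T\ge0$ such that with $T_0=T$, $T_k=T_{k-1}+\epsilon_ka_k$, each $T_{k-1}$ is an even multiple of $a_k$ (0 included) when $\epsilon_k=+1$ and an odd multiple of $a_k$ when $\epsilon_k=-1$, and $T_0,\dots,T_n$ are pairwise distinct; equivalently some path with distinct vertices in some skip graph has consecutive edges that are arcs of sizes $a_1,\dots,a_n$. A pattern that is not realizable is forbidden. -}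

module Defs where

open import Data.Nat using (ℕ; _+_; _*_; suc)
open import Data.Product using (∃; _×_)
open import Data.Sum using (_⊎_)
open import Data.List using (List; []; _∷_)
open import Data.List.Relation.Unary.Unique.Propositional using (Unique)
open import Data.List.Relation.Unary.All using (All)
open import Relation.Binary.PropositionalEquality using (_≡_)
open import Relation.Nullary using (¬_)

-- One arc step of size a from t to t':
--   sign +1: t is an even multiple 2ja of a (0 included) and t' = t + a;
--   sign -1: t is an odd multiple (2j+1)a of a and t' = t - a (written t' + a = t).
Step : ℕ → ℕ → ℕ → Set
Step a t t' =
  (∃ λ j → (t ≡ 2 * j * a) × (t' ≡ t + a))
  ⊎ (∃ λ j → (t ≡ (2 * j + 1) * a) × (t' + a ≡ t))

data Walk : ℕ → List ℕ → List ℕ → Set where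
  done : ∀ {t} → Walk t [] []
  step : ∀ {t t' a as ts} → Step a t t' → Walk t' as ts → Walk t (a ∷ as) (t' ∷ ts)

Realizable : List ℕ → Set
Realizable p = ∃ λ t → ∃ λ ts → Walk t p ts × Unique (t ∷ ts)

Forbidden : List ℕ → Set
Forbidden p = ¬ Realizable p

-- The first three arcs show that a divides b: a divides T₁ and T₂, the two
-- ends of the middle b-arc, hence their difference b; symmetrically b divides
-- a, using T₂ and T₃.  So a = b, and the first two arcs have equal size.  But
-- the a-arcs form a perfect matching on the multiples of a (a multiple is the
-- start of an arc if its quotient is even and the end of one if it is odd),
-- so two consecutive a-arcs retrace each other and T₂ = T₀.
module Submission where

open import Defs
open import Data.Nat using (ℕ; suc; _+_; _*_; NonZero)
open import Data.Nat.Properties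
  using (+-comm; *-comm; *-identityˡ; *-distribʳ-+; +-cancelʳ-≡; *-cancelʳ-≡; 0≢1+n)
open import Data.Nat.DivMod using (_%_; %-congˡ; m*n%n≡0; [m+kn]%n≡m%n)
open import Data.Nat.Divisibility
  using (_∣_; divides; ∣-refl; ∣-antisym; ∣m∣n⇒∣m+n; ∣m+n∣m⇒∣n)
open import Data.Product using (_,_)
open import Data.Sum using (inj₁; inj₂)
open import Data.List using (_∷_; [])
open import Data.List.Relation.Unary.All using (_∷_)
open import Data.List.Relation.Unary.AllPairs using (_∷_)
open import Relation.Binary.PropositionalEquality
  using (_≡_; _≢_; sym; trans; cong; subst; module ≡-Reasoning)
open import Relation.Nullary using (contradiction)

2*m≢1+2*n : ∀ m n → 2 * m ≢ 1 + 2 * n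
2*m≢1+2*n m n eq = 0≢1+n (begin
  0                ≡⟨ sym (m*n%n≡0 m 2) ⟩
  (m * 2) % 2      ≡⟨ %-congˡ (trans (*-comm m 2) (trans eq (cong suc (*-comm 2 n)))) ⟩
  (1 + n * 2) % 2  ≡⟨ [m+kn]%n≡m%n 1 n 2 ⟩
  1                ∎)
  where open ≡-Reasoning

even*≢odd* : ∀ a .{{_ : NonZero a}} j k → 2 * j * a ≢ (2 * k + 1) * a
even*≢odd* a j k eq =
  2*m≢1+2*n j k (trans (*-cancelʳ-≡ (2 * j) (2 * k + 1) a eq) (+-comm (2 * k) 1))

even*+≡odd* : ∀ a j → 2 * j * a + a ≡ (2 * j + 1) * a
even*+≡odd* a j = sym (begin
  (2 * j + 1) * a    ≡⟨ *-distribʳ-+ a (2 * j) 1 ⟩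
  2 * j * a + 1 * a  ≡⟨ cong (2 * j * a +_) (*-identityˡ a) ⟩
  2 * j * a + a      ∎)
  where open ≡-Reasoning

Step⇒∣size : ∀ {b c t t'} → c ∣ t → c ∣ t' → Step b t t' → c ∣ b
Step⇒∣size {c = c} c∣t c∣t' (inj₁ (_ , _ , t'≡t+b)) = ∣m+n∣m⇒∣n (subst (c ∣_) t'≡t+b c∣t') c∣t
Step⇒∣size {c = c} c∣t c∣t' (inj₂ (_ , _ , t'+b≡t)) = ∣m+n∣m⇒∣n (subst (c ∣_) (sym t'+b≡t) c∣t) c∣t'

Step⇒∣source : ∀ {a t t'} → Step a t t' → a ∣ t
Step⇒∣source (inj₁ (j , t≡2ja , _)) = divides (2 * j) t≡2ja
Step⇒∣source (inj₂ (j , t≡[2j+1]a , _)) = divides (2 * j + 1) t≡[2j+1]a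

Step⇒∣target : ∀ {a t t'} → Step a t t' → a ∣ t'
Step⇒∣target {a} s@(inj₁ (_ , _ , t'≡t+a)) = subst (a ∣_) (sym t'≡t+a) (∣m∣n⇒∣m+n (Step⇒∣source s) ∣-refl)
Step⇒∣target {a} s@(inj₂ (_ , _ , t'+a≡t)) =
  ∣m+n∣m⇒∣n (subst (a ∣_) (trans (sym t'+a≡t) (+-comm _ a)) (Step⇒∣source s)) ∣-refl

Step-retrace : ∀ {a t₀ t₁ t₂} .{{_ : NonZero a}} → Step a t₀ t₁ → Step a t₁ t₂ → t₀ ≡ t₂
Step-retrace {a} (inj₁ (j , t₀≡2ja , t₁≡t₀+a)) (inj₁ (k , t₁≡2ka , _)) =
  contradiction (trans (sym t₁≡2ka) (trans t₁≡t₀+a (trans (cong (_+ a) t₀≡2ja) (even*+≡odd* a j))))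
                (even*≢odd* a k j)
Step-retrace {a} {t₀} {_} {t₂} (inj₁ (_ , _ , t₁≡t₀+a)) (inj₂ (_ , _ , t₂+a≡t₁)) =
  +-cancelʳ-≡ a t₀ t₂ (trans (sym t₁≡t₀+a) (sym t₂+a≡t₁))
Step-retrace (inj₂ (_ , _ , t₁+a≡t₀)) (inj₁ (_ , _ , t₂≡t₁+a)) = trans (sym t₁+a≡t₀) (sym t₂≡t₁+a)
Step-retrace {a} {t₀} {t₁} (inj₂ (j , t₀≡[2j+1]a , t₁+a≡t₀)) (inj₂ (k , t₁≡[2k+1]a , _)) =
  contradiction (trans (sym t₁≡2ja) t₁≡[2k+1]a) (even*≢odd* a j k)
  where
    t₁≡2ja : t₁ ≡ 2 * j * a
    t₁≡2ja = +-cancelʳ-≡ a t₁ (2 * j * a) (trans t₁+a≡t₀ (trans t₀≡[2j+1]a (sym (even*+≡odd* a j))))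

claim4 : (a b : ℕ) → Forbidden (suc a ∷ suc b ∷ suc a ∷ suc b ∷ [])
claim4 a b (t₀ , (t₁ ∷ t₂ ∷ _ ∷ _ ∷ []) , step s₁ (step s₂ (step s₃ (step s₄ done))) , (_ ∷ t₀≢t₂ ∷ _) ∷ _) =
  t₀≢t₂ (Step-retrace s₁ (subst (λ c → Step c t₁ t₂) (sym a≡b) s₂))
  where
    a∣b : suc a ∣ suc b
    a∣b = Step⇒∣size (Step⇒∣target s₁) (Step⇒∣source s₃) s₂

    b∣a : suc b ∣ suc a
    b∣a = Step⇒∣size (Step⇒∣target s₂) (Step⇒∣source s₄) s₃

    a≡b : suc a ≡ suc b
    a≡b = ∣-antisym a∣b b∣a
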